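{- If $n=p^r$ with $p$ prime and $r\geq1$ an integer, then $T(n)=\sum_{k=0}^{r}T(p^k-1)$.
   Context: For a vector $A=(a_1,\ldots,a_k)$, $k\geq 1$, of positive integers define $f(A)$ recursively by $f(a_1)=a_1$ and $f(a_1,\ldots,a_{i+1})=(f(a_1,\ldots,a_i)+1)\,a_{i+1}$. For a positive integer $n$, $T(n)$ is the number of vectors $A$ (of any length $k\geq1$, with positive integer entries) such that $f(A)=n$; also $T(0):=1$. -}

module Defs where

open import Data.Nat using (ℕ; zero; suc; _+_; _*_; _^_; _≟_)
open import Data.Nat.Primality using (Prime)
open import Data.List using (List; []; _∷_; map; concatMap; filter; length; upTo; applyUpTo)
open import Data.Nat.ListAction using (sum)
open import Data.List.NonEmpty using (List⁺; _∷_)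
open import Relation.Nullary.Decidable using (⌊_⌋)

fgo : ℕ → List ℕ → ℕ
fgo acc []       = acc
fgo acc (a ∷ as) = fgo ((acc + 1) * a) as

f : List⁺ ℕ → ℕ
f (a ∷ as) = fgo a as

pos : ℕ → List ℕ
pos n = applyUpTo suc n

listsOf : ℕ → ℕ → List (List ℕ)
listsOf n zero    = [] ∷ []
listsOf n (suc k) = concatMap (λ a → map (a ∷_) (listsOf n k)) (pos n)

-- all nonempty vectors of length 1..n with entries in 1..n
-- (any A with f(A) = n ≥ 1 has every entry ≤ n and length ≤ n)
candidates : ℕ → List (List⁺ ℕ)
candidates n = concatMap listsOf⁺ (upTo n)
  where
  listsOf⁺ : ℕ → List (List⁺ ℕ)
  listsOf⁺ k = concatMap (λ a → map (a ∷_) (listsOf n k)) (pos n)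

T : ℕ → ℕ
T zero    = 1
T (suc m) = length (filter (λ A → f A ≟ suc m) (candidates (suc m)))

sumTo : ℕ → (ℕ → ℕ) → ℕ
sumTo r g = sum (map g (upTo (suc r)))

{-# OPTIONS --safe #-}
module Submission where

-- Sort the vectors A with f(A) = n ≥ 1 by their last entry d.  Then d ∣ n, and the
-- prefix of A has value n/d − 1, where the empty prefix is given value 0 (matching
-- T(0) = 1); hence T(n) = Σ_{d ∣ n} T(n/d − 1).  For n = p^r the divisors are the p^j
-- with j ≤ r, and p^r/p^j = p^(r−j).  Because T counts vectors inside an explicit
-- finite box, the prefix count must be shown independent of the box; this holds since
-- both the entries and the length of a vector are bounded by its value.

open import Defs
open import Data.Nat using (ℕ; zero; suc; _+_; _*_; _∸_; _^_; _≤_; _<_; _≥_; z≤n; s≤s; _≟_; _≤?_; NonZero; nonTrivial⇒n>1)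
open import Data.Nat.Properties
open import Data.Nat.Divisibility using (_∣_; divides; quotient; _∣?_; ∣1⇒≡1; >⇒∤; *-cancelˡ-∣)
open import Data.Nat.Primality using (Prime; prime⇒nonZero; prime⇒nonTrivial; prime⇒irreducible)
open import Data.Nat.Coprimality using (Coprime; coprime-divisor)
open import Data.Nat.ListAction using (sum)
open import Data.Nat.ListAction.Properties using (sum-++)
open import Data.List using (List; []; _∷_; _++_; _∷ʳ_; map; concatMap; filter; length; upTo; applyUpTo)
open import Data.List.Properties using (map-++; map-cong; map-cong-local; map-∘; map-applyUpTo; applyUpTo-∷ʳ)
open import Data.List.Membership.Propositional.Properties using (∈-upTo⁻)
import Data.List.Relation.Unary.All as All
open import Data.List.NonEmpty using (List⁺) renaming (_∷_ to _∷⁺_)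
open import Data.Product using (∃-syntax; _×_; _,_)
open import Data.Sum using (inj₁; inj₂; [_,_]′)
open import Function using (_∘_)
open import Relation.Binary using (tri<; tri≈; tri>)
open import Relation.Binary.PropositionalEquality using (_≡_; _≢_; refl; sym; trans; cong; cong₂; subst; module ≡-Reasoning)
open import Relation.Nullary using (Dec; yes; no; ¬_; contradiction)
open import Relation.Unary using (Decidable)
open import Algebra.Properties.CommutativeSemigroup +-commutativeSemigroup using (interchange)

[_]·_ : {P : Set} → Dec P → ℕ → ℕ
[ yes _ ]· x = x
[ no _ ]·  _ = 0

infixr 7 [_]·_

module _ {P : Set} {x : ℕ} where

  []·-yes : (P? : Dec P) → P → [ P? ]· x ≡ x
  []·-yes (yes _) _ = refl
  []·-yes (no ¬p) p = contradiction p ¬p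

  []·-no : (P? : Dec P) → ¬ P → [ P? ]· x ≡ 0
  []·-no (yes p) ¬p = contradiction p ¬p
  []·-no (no _)  _  = refl

[]·-⇔ : {P Q : Set} (P? : Dec P) (Q? : Dec Q) {x : ℕ} → (P → Q) → (Q → P) → [ P? ]· x ≡ [ Q? ]· x
[]·-⇔ (yes p) Q? P⇒Q _   = sym ([]·-yes Q? (P⇒Q p))
[]·-⇔ (no ¬p) Q? _   Q⇒P = sym ([]·-no Q? (¬p ∘ Q⇒P))

∑ : {A : Set} → List A → (A → ℕ) → ℕ
∑ xs g = sum (map g xs)

infix 5 ∑
syntax ∑ xs (λ x → e) = ∑[ x ∈ xs ] e

module _ {A : Set} where

  ∑-cong : (xs : List A) {g h : A → ℕ} → (∀ x → g x ≡ h x) → ∑ xs g ≡ ∑ xs h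
  ∑-cong xs g≗h = cong sum (map-cong g≗h xs)

  ∑-zero : (xs : List A) {g : A → ℕ} → (∀ x → g x ≡ 0) → ∑ xs g ≡ 0
  ∑-zero []       g≗0 = refl
  ∑-zero (x ∷ xs) g≗0 = cong₂ _+_ (g≗0 x) (∑-zero xs g≗0)

  ∑-++ : (xs ys : List A) (g : A → ℕ) → ∑ (xs ++ ys) g ≡ ∑ xs g + ∑ ys g
  ∑-++ xs ys g = trans (cong sum (map-++ g xs ys)) (sum-++ (map g xs) (map g ys))

  ∑-+ : (xs : List A) (g h : A → ℕ) → ∑[ x ∈ xs ] (g x + h x) ≡ ∑ xs g + ∑ xs h
  ∑-+ []       g h = refl
  ∑-+ (x ∷ xs) g h = trans (cong (g x + h x +_) (∑-+ xs g h)) (interchange (g x) (h x) _ _)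

module _ {A B : Set} where

  ∑-map : (xs : List A) (k : A → B) (g : B → ℕ) → ∑ (map k xs) g ≡ ∑ xs (g ∘ k)
  ∑-map xs k g = cong sum (sym (map-∘ xs))

  ∑-concatMap : (xs : List A) (k : A → List B) (g : B → ℕ) →
                ∑ (concatMap k xs) g ≡ ∑[ x ∈ xs ] ∑ (k x) g
  ∑-concatMap []       k g = refl
  ∑-concatMap (x ∷ xs) k g =
    trans (∑-++ (k x) (concatMap k xs) g) (cong (∑ (k x) g +_) (∑-concatMap xs k g))

  ∑-swap : (xs : List A) (ys : List B) (g : A → B → ℕ) →
           ∑[ x ∈ xs ] ∑[ y ∈ ys ] g x y ≡ ∑[ y ∈ ys ] ∑[ x ∈ xs ] g x y
  ∑-swap []       ys g = sym (∑-zero ys (λ _ → refl))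
  ∑-swap (x ∷ xs) ys g = trans (cong (∑ ys (g x) +_) (∑-swap xs ys g)) (sym (∑-+ ys (g x) _))

∑-concatMap-map : {A B C : Set} (xs : List A) (ys : List B) (c : A → B → C) (h : C → ℕ) →
                  ∑ (concatMap (λ x → map (c x) ys) xs) h ≡ ∑[ x ∈ xs ] ∑[ y ∈ ys ] h (c x y)
∑-concatMap-map xs ys c h =
  trans (∑-concatMap xs _ h) (∑-cong xs (λ x → ∑-map ys (c x) h))

∑< : ℕ → (ℕ → ℕ) → ℕ
∑< n g = ∑ (upTo n) g

infix 5 ∑<
syntax ∑< n (λ i → e) = ∑[ i < n ] e

∑<-cong : ∀ n {g h : ℕ → ℕ} → (∀ i → i < n → g i ≡ h i) → ∑< n g ≡ ∑< n h
∑<-cong n g≗h = cong sum (map-cong-local (All.tabulate (λ i∈ → g≗h _ (∈-upTo⁻ i∈))))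

∑<-zero : ∀ n {g : ℕ → ℕ} → (∀ i → i < n → g i ≡ 0) → ∑< n g ≡ 0
∑<-zero n g≗0 = trans (∑<-cong n g≗0) (∑-zero (upTo n) (λ _ → refl))

∑-applyUpTo : ∀ (f : ℕ → ℕ) n (g : ℕ → ℕ) → ∑ (applyUpTo f n) g ≡ ∑[ i < n ] g (f i)
∑-applyUpTo f n g = cong sum (trans (map-applyUpTo f g n) (sym (map-applyUpTo (λ i → i) (g ∘ f) n)))

∑<-suc : ∀ n (g : ℕ → ℕ) → ∑[ i < suc n ] g i ≡ g 0 + (∑[ i < n ] g (suc i))
∑<-suc n g = cong (g 0 +_) (∑-applyUpTo suc n g)

∑<-∷ʳ : ∀ n (g : ℕ → ℕ) → ∑[ i < suc n ] g i ≡ (∑[ i < n ] g i) + g n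
∑<-∷ʳ n g = begin
  ∑ (upTo (suc n)) g          ≡⟨ cong (λ is → ∑ is g) (sym (applyUpTo-∷ʳ (λ i → i) n)) ⟩
  ∑ (upTo n ∷ʳ n) g           ≡⟨ ∑-++ (upTo n) (n ∷ []) g ⟩
  ∑ (upTo n) g + (g n + 0)    ≡⟨ cong (∑ (upTo n) g +_) (+-identityʳ (g n)) ⟩
  ∑ (upTo n) g + g n          ∎
  where open ≡-Reasoning

∑<-extend : ∀ m n {g : ℕ → ℕ} → m ≤ n → (∀ i → m ≤ i → i < n → g i ≡ 0) → ∑< n g ≡ ∑< m g
∑<-extend m zero    z≤n     _   = refl
∑<-extend m (suc n) {g} m≤1+n g≡0 with m≤n⇒m<n∨m≡n m≤1+n
... | inj₂ refl = refl
... | inj₁ m<1+n = begin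
  ∑< (suc n) g     ≡⟨ ∑<-∷ʳ n g ⟩
  ∑< n g + g n     ≡⟨ cong₂ _+_ (∑<-extend m n m≤n (λ i m≤i i<n → g≡0 i m≤i (m<n⇒m<1+n i<n)))
                                (g≡0 n m≤n ≤-refl) ⟩
  ∑< m g + 0       ≡⟨ +-identityʳ _ ⟩
  ∑< m g           ∎
  where
  open ≡-Reasoning
  m≤n = ≤-pred m<1+n

∑<-point : ∀ n i {g : ℕ → ℕ} → i < n → (∀ j → j < n → j ≢ i → g j ≡ 0) → ∑< n g ≡ g i
∑<-point (suc n) i {g} i<1+n g≡0 = begin
  ∑< (suc n) g       ≡⟨ ∑<-extend (suc i) (suc n) i<1+n (λ j i<j j<1+n → g≡0 j j<1+n (>⇒≢ i<j)) ⟩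
  ∑< (suc i) g       ≡⟨ ∑<-∷ʳ i g ⟩
  ∑< i g + g i       ≡⟨ cong (_+ g i) (∑<-zero i (λ j j<i → g≡0 j (<-trans j<i i<1+n) (<⇒≢ j<i))) ⟩
  g i                ∎
  where open ≡-Reasoning

∑<-reverse : ∀ r (g : ℕ → ℕ) → ∑[ j < suc r ] g (r ∸ j) ≡ ∑[ j < suc r ] g j
∑<-reverse zero    g = refl
∑<-reverse (suc r) g = begin
  ∑[ j < suc (suc r) ] g (suc r ∸ j)
    ≡⟨ ∑<-∷ʳ (suc r) (λ j → g (suc r ∸ j)) ⟩
  (∑[ j < suc r ] g (suc r ∸ j)) + g (r ∸ r)
    ≡⟨ cong₂ _+_ (∑<-cong (suc r) λ j j<1+r → cong g (+-∸-assoc 1 (≤-pred j<1+r))) (cong g (n∸n≡0 r)) ⟩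
  (∑[ j < suc r ] g (suc (r ∸ j))) + g 0
    ≡⟨ cong (_+ g 0) (∑<-reverse r (g ∘ suc)) ⟩
  (∑[ j < suc r ] g (suc j)) + g 0
    ≡⟨ +-comm _ (g 0) ⟩
  g 0 + (∑[ j < suc r ] g (suc j))
    ≡⟨ ∑<-suc (suc r) g ⟨
  ∑[ j < suc (suc r) ] g j ∎
  where open ≡-Reasoning

cofactor : ∀ {d n} → Dec (d ∣ n) → (ℕ → ℕ) → ℕ
cofactor (yes d∣n) g = g (quotient d∣n)
cofactor (no _)    _ = 0

cofactorSum : ℕ → ℕ → (ℕ → ℕ) → ℕ
cofactorSum B n g = ∑[ i < B ] cofactor (suc i ∣? n) g

quotient-unique : ∀ {d n q} .{{_ : NonZero d}} (d∣n : d ∣ n) → n ≡ q * d → quotient d∣n ≡ q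
quotient-unique {d} (divides c n≡c*d) n≡q*d = *-cancelʳ-≡ c _ d (trans (sym n≡c*d) n≡q*d)

quotient-≤ : ∀ {d n} .{{_ : NonZero d}} (d∣n : d ∣ n) → quotient d∣n ≤ n
quotient-≤ {d} (divides c refl) = m≤m*n c d

∑-cofactor : {A : Set} (xs : List A) {d n : ℕ} (d∣?n : Dec (d ∣ n)) (g : A → ℕ → ℕ) →
             ∑[ x ∈ xs ] cofactor d∣?n (g x) ≡ cofactor d∣?n (λ e → ∑[ x ∈ xs ] g x e)
∑-cofactor xs (yes _) g = refl
∑-cofactor xs (no _)  g = ∑-zero xs (λ _ → refl)

∑-cofactorSum : {A : Set} (xs : List A) (B n : ℕ) (g : A → ℕ → ℕ) →
                ∑[ x ∈ xs ] cofactorSum B n (g x) ≡ cofactorSum B n (λ e → ∑[ x ∈ xs ] g x e)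
∑-cofactorSum xs B n g =
  trans (∑-swap xs (upTo B) _) (∑-cong (upTo B) (λ i → ∑-cofactor xs (suc i ∣? n) g))

module _ (B n : ℕ) {g : ℕ → ℕ} where

  cofactorSum-cong : {h : ℕ → ℕ} → (∀ e → e ≤ n → g e ≡ h e) → cofactorSum B n g ≡ cofactorSum B n h
  cofactorSum-cong {h} g≗h = ∑-cong (upTo B) term
    where
    term : ∀ i → cofactor (suc i ∣? n) g ≡ cofactor (suc i ∣? n) h
    term i with suc i ∣? n
    ... | yes d∣n = g≗h _ (quotient-≤ d∣n)
    ... | no _    = refl

  cofactorSum-zero : (∀ e → e ≤ n → g e ≡ 0) → cofactorSum B n g ≡ 0
  cofactorSum-zero g≗0 = trans (cofactorSum-cong g≗0) (∑-zero (upTo B) term)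
    where
    term : ∀ i → cofactor (suc i ∣? n) (λ _ → 0) ≡ 0
    term i with suc i ∣? n
    ... | yes _ = refl
    ... | no _  = refl

  cofactorSum-truncate : .{{_ : NonZero n}} → n ≤ B → cofactorSum B n g ≡ cofactorSum n n g
  cofactorSum-truncate n≤B = ∑<-extend n B n≤B term
    where
    term : ∀ i → n ≤ i → i < B → cofactor (suc i ∣? n) g ≡ 0
    term i n≤i _ with suc i ∣? n
    ... | yes d∣n = contradiction d∣n (>⇒∤ (s≤s n≤i))
    ... | no _    = refl

[≤?]·-suc : ∀ a M x → [ a ≤? suc M ]· x ≡ [ a ≤? M ]· x + [ a ≟ suc M ]· x
[≤?]·-suc a M x with a ≤? M | a ≟ suc M
... | yes a≤M | a≟1+M = trans ([]·-yes (a ≤? suc M) (m≤n⇒m≤1+n a≤M))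
                              (sym (trans (cong (x +_) ([]·-no a≟1+M (λ { refl → 1+n≰n a≤M })))
                                          (+-identityʳ x)))
... | no _    | yes refl = []·-yes (a ≤? suc M) ≤-refl
... | no a≰M  | no a≢1+M = []·-no (a ≤? suc M) λ a≤1+M → [ a≰M ∘ ≤-pred , a≢1+M ]′ (m≤n⇒m<n∨m≡n a≤1+M)

module _ {p : ℕ} (p-prime : Prime p) where

  private instance
    p≢0 : NonZero p
    p≢0 = prime⇒nonZero p-prime

  private
    1<p : 1 < p
    1<p = nonTrivial⇒n>1 p {{prime⇒nonTrivial p-prime}}

  ^-injective : ∀ {i j} → p ^ i ≡ p ^ j → i ≡ j
  ^-injective {i} {j} p^i≡p^j with <-cmp i j
  ... | tri< i<j _ _ = contradiction p^i≡p^j (<⇒≢ (^-monoʳ-< p 1<p i<j))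
  ... | tri≈ _ i≡j _ = i≡j
  ... | tri> _ _ j<i = contradiction (sym p^i≡p^j) (<⇒≢ (^-monoʳ-< p 1<p j<i))

  ^-split : ∀ {j r} → j ≤ r → p ^ r ≡ p ^ (r ∸ j) * p ^ j
  ^-split {j} {r} j≤r = trans (cong (p ^_) (sym (m∸n+n≡m j≤r))) (^-distribˡ-+-* p (r ∸ j) j)

  ∤⇒coprime : ∀ {d} → ¬ p ∣ d → Coprime d p
  ∤⇒coprime p∤d (c∣d , c∣p) with prime⇒irreducible p-prime c∣p
  ... | inj₁ c≡1 = c≡1
  ... | inj₂ refl = contradiction c∣d p∤d

  ∣p^⇒≡p^ : ∀ r {d} → d ∣ p ^ r → ∃[ j ] j ≤ r × d ≡ p ^ j
  ∣p^⇒≡p^ zero    d∣1 = 0 , z≤n , ∣1⇒≡1 d∣1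
  ∣p^⇒≡p^ (suc r) {d} d∣p^1+r with p ∣? d
  ... | no p∤d with j , j≤r , d≡p^j ← ∣p^⇒≡p^ r (coprime-divisor (∤⇒coprime p∤d) d∣p^1+r)
    = j , m≤n⇒m≤1+n j≤r , d≡p^j
  ... | yes (divides c refl)
    with j , j≤r , refl ← ∣p^⇒≡p^ r (*-cancelˡ-∣ p (subst (_∣ p ^ suc r) (*-comm c p) d∣p^1+r))
    = suc j , s≤s j≤r , *-comm (p ^ j) p

  module _ (r : ℕ) (g : ℕ → ℕ) where

    private
      cofactor-p^ : ∀ c → cofactor (suc c ∣? p ^ r) g ≡ ∑[ j < suc r ] [ p ^ j ≟ suc c ]· g (p ^ (r ∸ j))
      cofactor-p^ c with suc c ∣? p ^ r
      ... | no c∤p^r = sym (∑<-zero (suc r) λ j j<1+r → []·-no (p ^ j ≟ suc c) λ p^j≡1+c →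
              c∤p^r (subst (_∣ p ^ r) p^j≡1+c (divides (p ^ (r ∸ j)) (^-split (≤-pred j<1+r)))))
      ... | yes c∣p^r with j₀ , j₀≤r , 1+c≡p^j₀ ← ∣p^⇒≡p^ r c∣p^r = sym (begin
        ∑[ j < suc r ] [ p ^ j ≟ suc c ]· g (p ^ (r ∸ j))
          ≡⟨ ∑<-point (suc r) j₀ (s≤s j₀≤r) (λ j _ j≢j₀ → []·-no (p ^ j ≟ suc c)
               (λ p^j≡1+c → j≢j₀ (^-injective (trans p^j≡1+c 1+c≡p^j₀)))) ⟩
        [ p ^ j₀ ≟ suc c ]· g (p ^ (r ∸ j₀))
          ≡⟨ []·-yes (p ^ j₀ ≟ suc c) (sym 1+c≡p^j₀) ⟩
        g (p ^ (r ∸ j₀))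
          ≡⟨ cong g (quotient-unique c∣p^r r≡) ⟨
        g (quotient c∣p^r) ∎)
        where
        open ≡-Reasoning
        r≡ : p ^ r ≡ p ^ (r ∸ j₀) * suc c
        r≡ = trans (^-split j₀≤r) (cong (p ^ (r ∸ j₀) *_) (sym 1+c≡p^j₀))

      cofactorSum-p^-partial : ∀ M → cofactorSum M (p ^ r) g ≡ ∑[ j < suc r ] [ p ^ j ≤? M ]· g (p ^ (r ∸ j))
      cofactorSum-p^-partial zero = sym (∑<-zero (suc r) λ j _ → []·-no (p ^ j ≤? 0) (<⇒≱ (m^n>0 p j)))
      cofactorSum-p^-partial (suc M) = begin
        cofactorSum (suc M) (p ^ r) g
          ≡⟨ ∑<-∷ʳ M _ ⟩
        cofactorSum M (p ^ r) g + cofactor (suc M ∣? p ^ r) g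
          ≡⟨ cong₂ _+_ (cofactorSum-p^-partial M) (cofactor-p^ M) ⟩
        ∑< (suc r) below + ∑< (suc r) at
          ≡⟨ ∑-+ (upTo (suc r)) below at ⟨
        ∑[ j < suc r ] (below j + at j)
          ≡⟨ ∑-cong (upTo (suc r)) (λ j → [≤?]·-suc (p ^ j) M _) ⟨
        ∑[ j < suc r ] [ p ^ j ≤? suc M ]· g (p ^ (r ∸ j)) ∎
        where
        open ≡-Reasoning
        below at : ℕ → ℕ
        below j = [ p ^ j ≤? M ]· g (p ^ (r ∸ j))
        at    j = [ p ^ j ≟ suc M ]· g (p ^ (r ∸ j))

    cofactorSum-prime-power : cofactorSum (p ^ r) (p ^ r) g ≡ ∑[ k < suc r ] g (p ^ k)
    cofactorSum-prime-power = begin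
      cofactorSum (p ^ r) (p ^ r) g
        ≡⟨ cofactorSum-p^-partial (p ^ r) ⟩
      ∑[ j < suc r ] [ p ^ j ≤? p ^ r ]· g (p ^ (r ∸ j))
        ≡⟨ ∑<-cong (suc r) (λ j j<1+r → []·-yes (p ^ j ≤? p ^ r) (^-monoʳ-≤ p (≤-pred j<1+r))) ⟩
      ∑[ j < suc r ] g (p ^ (r ∸ j))
        ≡⟨ ∑<-reverse r (g ∘ (p ^_)) ⟩
      ∑[ k < suc r ] g (p ^ k) ∎
      where open ≡-Reasoning

f₀ : List ℕ → ℕ
f₀ = fgo 0

f₀-∷ : ∀ a as → f₀ (a ∷ as) ≡ f (a ∷⁺ as)
f₀-∷ a as = cong (λ acc → fgo acc as) (+-identityʳ a)

fgo-∷ʳ : ∀ acc xs a → fgo acc (xs ∷ʳ a) ≡ (fgo acc xs + 1) * a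
fgo-∷ʳ acc []       a = refl
fgo-∷ʳ acc (x ∷ xs) a = fgo-∷ʳ ((acc + 1) * x) xs a

count : ℕ → ℕ → ℕ → ℕ
count B L v = ∑[ xs ∈ listsOf B L ] [ f₀ xs ≟ v ]· 1

length-filter : {A : Set} {P : A → Set} (P? : Decidable P) (xs : List A) →
                length (filter P? xs) ≡ ∑[ x ∈ xs ] [ P? x ]· 1
length-filter P? []       = refl
length-filter P? (x ∷ xs) with P? x
... | yes _ = cong suc (length-filter P? xs)
... | no _  = length-filter P? xs

∑-listsOf-∷ʳ : ∀ B L (h : List ℕ → ℕ) →
               ∑[ xs ∈ listsOf B (suc L) ] h xs ≡ ∑[ a ∈ pos B ] ∑[ xs ∈ listsOf B L ] h (xs ∷ʳ a)
∑-listsOf-∷ʳ B zero    h = ∑-concatMap-map (pos B) (listsOf B 0) _∷_ h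
∑-listsOf-∷ʳ B (suc L) h = begin
  ∑[ xs ∈ listsOf B (suc (suc L)) ] h xs
    ≡⟨ ∑-concatMap-map (pos B) (listsOf B (suc L)) _∷_ h ⟩
  ∑[ b ∈ pos B ] ∑[ ys ∈ listsOf B (suc L) ] h (b ∷ ys)
    ≡⟨ ∑-cong (pos B) (λ b → ∑-listsOf-∷ʳ B L (h ∘ (b ∷_))) ⟩
  ∑[ b ∈ pos B ] ∑[ a ∈ pos B ] ∑[ xs ∈ listsOf B L ] h (b ∷ (xs ∷ʳ a))
    ≡⟨ ∑-swap (pos B) (pos B) _ ⟩
  ∑[ a ∈ pos B ] ∑[ b ∈ pos B ] ∑[ xs ∈ listsOf B L ] h ((b ∷ xs) ∷ʳ a)
    ≡⟨ ∑-cong (pos B) (λ a → ∑-concatMap-map (pos B) (listsOf B L) _∷_ (h ∘ (_∷ʳ a))) ⟨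
  ∑[ a ∈ pos B ] ∑[ ys ∈ listsOf B (suc L) ] h (ys ∷ʳ a) ∎
  where open ≡-Reasoning

count-suc : ∀ B L v → count B (suc L) v ≡ ∑[ i < B ] ∑[ xs ∈ listsOf B L ] [ (f₀ xs + 1) * suc i ≟ v ]· 1
count-suc B L v = begin
  count B (suc L) v
    ≡⟨ ∑-listsOf-∷ʳ B L _ ⟩
  ∑[ a ∈ pos B ] ∑[ xs ∈ listsOf B L ] [ f₀ (xs ∷ʳ a) ≟ v ]· 1
    ≡⟨ ∑-cong (pos B) (λ a → ∑-cong (listsOf B L) (λ xs → cong (λ w → [ w ≟ v ]· 1) (fgo-∷ʳ 0 xs a))) ⟩
  ∑[ a ∈ pos B ] ∑[ xs ∈ listsOf B L ] [ (f₀ xs + 1) * a ≟ v ]· 1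
    ≡⟨ ∑-applyUpTo suc B _ ⟩
  ∑[ i < B ] ∑[ xs ∈ listsOf B L ] [ (f₀ xs + 1) * suc i ≟ v ]· 1 ∎
  where open ≡-Reasoning

count-suc-zero : ∀ B L → count B (suc L) 0 ≡ 0
count-suc-zero B L = trans (count-suc B L 0)
  (∑-zero (upTo B) λ i → ∑-zero (listsOf B L) λ xs → []·-no ((f₀ xs + 1) * suc i ≟ 0)
    (λ eq → 1+n≢0 (trans (cong (_* suc i) (+-comm 1 (f₀ xs))) eq)))

last-entry : ∀ x i w → [ (x + 1) * suc i ≟ suc w ]· 1 ≡ cofactor (suc i ∣? suc w) (λ e → [ x ≟ e ∸ 1 ]· 1)
last-entry x i w with suc i ∣? suc w
... | no i∤w = []·-no ((x + 1) * suc i ≟ suc w) (λ eq → i∤w (divides (x + 1) (sym eq)))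
... | yes (divides (suc c) 1+w≡) = []·-⇔ ((x + 1) * suc i ≟ suc w) (x ≟ c)
  (λ eq → suc-injective (trans (+-comm 1 x) (*-cancelʳ-≡ (x + 1) (suc c) (suc i) (trans eq 1+w≡))))
  (λ { refl → trans (cong (_* suc i) (+-comm c 1)) (sym 1+w≡) })

count-suc-suc : ∀ B L w → count B (suc L) (suc w) ≡ cofactorSum B (suc w) (λ e → count B L (e ∸ 1))
count-suc-suc B L w = trans (count-suc B L (suc w)) (∑-cong (upTo B) λ i →
  trans (∑-cong (listsOf B L) (λ xs → last-entry (f₀ xs) i w))
        (∑-cofactor (listsOf B L) (suc i ∣? suc w) (λ xs e → [ f₀ xs ≟ e ∸ 1 ]· 1)))

∸1-≤ : ∀ {e w} → e ≤ suc w → e ∸ 1 ≤ w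
∸1-≤ = ∸-monoˡ-≤ 1

count-too-long : ∀ L v B → v < L → count B L v ≡ 0
count-too-long (suc L) zero    B _ = count-suc-zero B L
count-too-long (suc L) (suc w) B (s≤s w<L) = trans (count-suc-suc B L w)
  (cofactorSum-zero B (suc w) λ e e≤1+w → count-too-long L (e ∸ 1) B (≤-<-trans (∸1-≤ e≤1+w) w<L))

count-bound-irrelevant : ∀ L v B → v ≤ B → count B L v ≡ count v L v
count-bound-irrelevant zero    v       B _ = refl
count-bound-irrelevant (suc L) zero    B _ = trans (count-suc-zero B L) (sym (count-suc-zero 0 L))
count-bound-irrelevant (suc L) (suc w) B 1+w≤B = begin
  count B (suc L) (suc w)
    ≡⟨ count-suc-suc B L w ⟩
  cofactorSum B (suc w) (λ e → count B L (e ∸ 1))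
    ≡⟨ cofactorSum-truncate B (suc w) 1+w≤B ⟩
  cofactorSum (suc w) (suc w) (λ e → count B L (e ∸ 1))
    ≡⟨ cofactorSum-cong (suc w) (suc w) (λ e e≤1+w →
         trans (count-bound-irrelevant L (e ∸ 1) B (≤-trans (∸1-≤ e≤1+w) (≤-trans (n≤1+n w) 1+w≤B)))
               (sym (count-bound-irrelevant L (e ∸ 1) (suc w) (m≤n⇒m≤1+n (∸1-≤ e≤1+w))))) ⟩
  cofactorSum (suc w) (suc w) (λ e → count (suc w) L (e ∸ 1))
    ≡⟨ count-suc-suc (suc w) L w ⟨
  count (suc w) (suc L) (suc w) ∎
  where open ≡-Reasoning

T-unfold : ∀ w → T w ≡ ∑[ L < suc w ] count w L w
T-unfold zero    = refl
T-unfold (suc m) = begin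
  T n
    ≡⟨ length-filter (λ A → f A ≟ n) (candidates n) ⟩
  ∑[ A ∈ candidates n ] [ f A ≟ n ]· 1
    ≡⟨ ∑-concatMap (upTo n) nonEmptyOfLength (λ A → [ f A ≟ n ]· 1) ⟩
  ∑[ k < n ] ∑[ A ∈ nonEmptyOfLength k ] [ f A ≟ n ]· 1
    ≡⟨ ∑-cong (upTo n) (λ k → ∑-concatMap-map (pos n) (listsOf n k) _∷⁺_ _) ⟩
  ∑[ k < n ] ∑[ a ∈ pos n ] ∑[ as ∈ listsOf n k ] [ f (a ∷⁺ as) ≟ n ]· 1
    ≡⟨ ∑-cong (upTo n) (λ k → ∑-cong (pos n) λ a → ∑-cong (listsOf n k) λ as →
         cong (λ v → [ v ≟ n ]· 1) (f₀-∷ a as)) ⟨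
  ∑[ k < n ] ∑[ a ∈ pos n ] ∑[ as ∈ listsOf n k ] [ f₀ (a ∷ as) ≟ n ]· 1
    ≡⟨ ∑-cong (upTo n) (λ k → ∑-concatMap-map (pos n) (listsOf n k) _∷_ _) ⟨
  ∑[ k < n ] count n (suc k) n
    ≡⟨ ∑<-suc n (λ L → count n L n) ⟨
  ∑[ L < suc n ] count n L n ∎
  where
  open ≡-Reasoning
  n = suc m
  nonEmptyOfLength : ℕ → List (List⁺ ℕ)
  nonEmptyOfLength k = concatMap (λ a → map (a ∷⁺_) (listsOf n k)) (pos n)

T-as-∑count : ∀ B L w → w ≤ B → w ≤ L → ∑[ k < suc L ] count B k w ≡ T w
T-as-∑count B L w w≤B w≤L = begin
  ∑[ k < suc L ] count B k w   ≡⟨ ∑<-extend (suc w) (suc L) (s≤s w≤L) (λ k w<k _ → count-too-long k w B w<k) ⟩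
  ∑[ k < suc w ] count B k w   ≡⟨ ∑-cong (upTo (suc w)) (λ k → count-bound-irrelevant k w B w≤B) ⟩
  ∑[ k < suc w ] count w k w   ≡⟨ T-unfold w ⟨
  T w                          ∎
  where open ≡-Reasoning

T-recursion : ∀ n .{{_ : NonZero n}} → T n ≡ cofactorSum n n (λ e → T (e ∸ 1))
T-recursion n@(suc m) = begin
  T n
    ≡⟨ T-unfold n ⟩
  ∑[ k < suc n ] count n k n
    ≡⟨ ∑<-suc n (λ k → count n k n) ⟩
  ∑[ k < n ] count n (suc k) n
    ≡⟨ ∑-cong (upTo n) (λ k → count-suc-suc n k m) ⟩
  ∑[ k < n ] cofactorSum n n (λ e → count n k (e ∸ 1))
    ≡⟨ ∑-cofactorSum (upTo n) n n (λ k e → count n k (e ∸ 1)) ⟩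
  cofactorSum n n (λ e → ∑[ k < n ] count n k (e ∸ 1))
    ≡⟨ cofactorSum-cong n n (λ e e≤n →
         T-as-∑count n m (e ∸ 1) (m≤n⇒m≤1+n (∸1-≤ e≤n)) (∸1-≤ e≤n)) ⟩
  cofactorSum n n (λ e → T (e ∸ 1)) ∎
  where open ≡-Reasoning

corollary2 : (p r : ℕ) → Prime p → r ≥ 1 → T (p ^ r) ≡ sumTo r (λ k → T (p ^ k ∸ 1))
corollary2 p r p-prime _ = begin
  T (p ^ r)                                       ≡⟨ T-recursion (p ^ r) {{m^n≢0 p r}} ⟩
  cofactorSum (p ^ r) (p ^ r) (λ e → T (e ∸ 1))   ≡⟨ cofactorSum-prime-power p-prime r _ ⟩
  ∑[ k < suc r ] T (p ^ k ∸ 1)                    ∎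
  where
  open ≡-Reasoning
  instance
    p≢0 : NonZero p
    p≢0 = prime⇒nonZero p-prime
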